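{- Let $(X,\tau)$ be any topological space. Then $(X,\tau^+)$ is a $T_1$-space.
   Context: For $A\subseteq X$, $d_\tau(A)$ is the set of limit points of $A$. $\tau^+$ is the coarsest topology on $X$ containing $\tau$ in which every set $d_\tau(A)$, $A\subseteq X$, is open. -}

module Defs where

open import Level using (Level; _⊔_) renaming (suc to lsuc)
open import Data.Product using (Σ; ∃; _×_; _,_)
open import Relation.Unary using (Pred; _∈_; _∉_; _⊆_; _∩_)
open import Data.Unit using (⊤)
open import Relation.Binary.PropositionalEquality using (_≡_; _≢_)

Univ : ∀ {ℓ} {X : Set ℓ} (m : Level) → Pred X m
Univ m _ = Level.Lift m ⊤

⋃ : ∀ {ℓ} {X : Set ℓ} {I : Set ℓ} → (I → Pred X ℓ) → Pred X ℓ
⋃ {I = I} F x = Σ I λ i → x ∈ F i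

record Topology {ℓ} (X : Set ℓ) : Set (lsuc (lsuc ℓ)) where
  field
    Open      : Pred (Pred X ℓ) (lsuc ℓ)
    -- openness only depends on the extension of a subset (no funext in Agda)
    Open-ext  : ∀ {A B} → A ⊆ B → B ⊆ A → Open A → Open B
    Open-univ : Open (Univ ℓ)
    Open-∩    : ∀ {A B} → Open A → Open B → Open (A ∩ B)
    Open-⋃    : ∀ {I : Set ℓ} (F : I → Pred X ℓ) → (∀ i → Open (F i)) → Open (⋃ F)

open Topology public

-- d_τ(A): the set of limit points of A in (X, τ):
-- x ∈ d_τ(A) iff every τ-open neighbourhood of x meets A in a point other than x.
d : ∀ {ℓ} {X : Set ℓ} → Topology X → Pred X ℓ → Pred X (lsuc ℓ)
d τ A x = ∀ V → Open τ V → x ∈ V → ∃ λ z → z ∈ V × z ∈ A × z ≢ x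

-- Open sets of the topology generated by τ together with all sets d_τ(A):
-- the smallest family containing these and closed under the topology axioms,
-- i.e. the open sets of τ⁺ (the coarsest such topology).
data PlusOpen {ℓ} {X : Set ℓ} (τ : Topology X) : Pred (Pred X (lsuc ℓ)) (lsuc (lsuc ℓ)) where
  base  : ∀ {A : Pred X ℓ} → Open τ A → PlusOpen τ (λ x → Level.Lift (lsuc ℓ) (x ∈ A))
  dset  : (A : Pred X ℓ) → PlusOpen τ (d τ A)
  univ  : PlusOpen τ (Univ (lsuc ℓ))
  inter : ∀ {A B} → PlusOpen τ A → PlusOpen τ B → PlusOpen τ (A ∩ B)
  union : ∀ {I : Set (lsuc ℓ)} (F : I → Pred X (lsuc ℓ)) → (∀ i → PlusOpen τ (F i)) →
          PlusOpen τ (λ x → Σ I λ i → x ∈ F i)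
  ext   : ∀ {A B} → A ⊆ B → B ⊆ A → PlusOpen τ A → PlusOpen τ B

IsT₁ : ∀ {a s o} {X : Set a} → Pred (Pred X s) o → Set (a ⊔ lsuc s ⊔ o)
IsT₁ {X = X} Op = ∀ (x y : X) → x ≢ y → ∃ λ V → Op V × x ∈ V × y ∉ V

-- Fix distinct points x, y.  Classically, one of two cases occurs.
--   * Some τ-open set contains x but not y.  Since τ ⊆ τ⁺, that set
--     already separates x from y in τ⁺.
--   * Every τ-open neighbourhood of x contains y.  As y ≠ x, this says
--     exactly that x is a limit point of the singleton {y}.  On the other
--     hand no point is a limit point of its own singleton (the whole space
--     is a neighbourhood meeting {y} only in y).  Hence the τ⁺-open set
--     d_τ({y}) contains x but not y.
-- Excluded middle is only available at level suc ℓ, so it is first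
-- lowered to the level of the propositions "y ∈ V" it is applied to.
module Submission where

open import Level using (Level; Lift; lift; lower) renaming (suc to lsuc)
open import Axiom.ExcludedMiddle using (ExcludedMiddle)
open import Axiom.DoubleNegationElimination using (DoubleNegationElimination; em⇒dne)
open import Data.Product using (∃; _×_; _,_)
open import Relation.Nullary using (¬_; yes; no)
open import Relation.Nullary.Decidable using (map′)
open import Relation.Unary using (Pred; _∈_; _∉_)
open import Relation.Binary.PropositionalEquality using (_≡_; _≢_; refl; sym)
open import Defs

lowerExcludedMiddle : ∀ {ℓ} → ExcludedMiddle (lsuc ℓ) → ExcludedMiddle ℓ
lowerExcludedMiddle em = map′ lower lift em

module _ {ℓ} {X : Set ℓ} (τ : Topology X) where

  singleton : X → Pred X ℓ
  singleton y z = z ≡ y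

  Separated : X → X → Set (lsuc ℓ)
  Separated x y = ∃ λ V → Open τ V × x ∈ V × y ∉ V

  separated⇒plusSeparated : ∀ {x y} → Separated x y →
    ∃ λ V → PlusOpen τ V × x ∈ V × y ∉ V
  separated⇒plusSeparated (V , V-open , x∈V , y∉V) =
    (λ z → Lift (lsuc ℓ) (z ∈ V)) , base V-open , lift x∈V , λ y∈V → y∉V (lower y∈V)

  -- No point is a limit point of its own singleton: the whole space is a
  -- neighbourhood of y whose only point in {y} is y itself.
  not-limit-of-own-singleton : ∀ y → y ∉ d τ (singleton y)
  not-limit-of-own-singleton y y∈d with y∈d (Univ ℓ) (Open-univ τ) _
  ... | z , _ , z≡y , z≢y = z≢y z≡y

  inseparable⇒limit-of-singleton : DoubleNegationElimination ℓ → ∀ x y →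
    x ≢ y → ¬ Separated x y → x ∈ d τ (singleton y)
  inseparable⇒limit-of-singleton dne x y x≢y inseparable V V-open x∈V =
    y , y∈V , refl , λ y≡x → x≢y (sym y≡x)
    where
    y∈V : y ∈ V
    y∈V = dne λ y∉V → inseparable (V , V-open , x∈V , y∉V)

mainTheorem16 : ∀ {ℓ} → ExcludedMiddle (Level.suc ℓ) →
    (X : Set ℓ) (τ : Topology X) → IsT₁ (PlusOpen τ)
mainTheorem16 em X τ x y x≢y with em {Separated τ x y}
... | yes separated = separated⇒plusSeparated τ separated
... | no inseparable =
  d τ (singleton τ y) , dset (singleton τ y) ,
  inseparable⇒limit-of-singleton τ (em⇒dne (lowerExcludedMiddle em)) x y x≢y inseparable ,
  not-limit-of-own-singleton τ y
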